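{- Let $m\ge 2$ be an integer and $n=2m-1$. Then there exist $\left\lceil\frac{mn}{2m+n-1}\right\rceil$ subgraphs of $K_{m,n}$, each isomorphic to a double cycle with one white vertex removed whose black vertices are the $m$ vertices of the $m$-element class and whose white vertices are the $n$ vertices of the $n$-element class, such that every edge of $K_{m,n}$ belongs to at least one of them.
   Context: A double cycle is obtained from a cycle (a cycle on $2$ vertices, with two parallel edges, is allowed) by replacing each edge $\{u,v\}$ by a copy of $C_4$ with edges $\{u,x\},\{u,y\},\{v,x\},\{v,y\}$ where $x,y$ are new vertices; the vertices of the original cycle are black and the new vertices are white. Here the underlying cycle has length $m$, so the double cycle has $m$ black and $2m$ white vertices, and removing one white vertex leaves $2m-1$ white vertices. -}

module Defs where

open import Data.Nat using (ℕ; zero; suc; _+_; _*_; _∸_; _/_)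
open import Data.Nat.DivMod using (_mod_)
open import Data.Fin using (Fin; toℕ)
open import Data.Bool using (Bool; true)
open import Data.Product using (_×_; _,_; Σ-syntax)
open import Data.Sum using (_⊎_; inj₁)
open import Data.Unit using (⊤)
open import Relation.Binary.PropositionalEquality using (_≡_)
open import Relation.Nullary using (¬_)
open import Function.Bundles using (_↔_; Inverse; _⇔_)

ceilDiv : ℕ → (b : ℕ) → ℕ
ceilDiv a zero    = 0
ceilDiv a (suc b) = (a + b) / suc b

csuc : {m : ℕ} → Fin m → Fin m
csuc {suc k} i = suc (toℕ i) mod suc k

-- The double cycle over the cycle C_m on black vertices Fin m
-- (cycle edges e_i = {i, i+1 mod m}, i ∈ Fin m; for m = 2 these are two
-- parallel edges).  Each cycle edge e_i is replaced by a C_4 with the two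
-- new white vertices (i , 0) and (i , 1).
DCAdj : (m : ℕ) → Fin m → Fin m × Fin 2 → Set
DCAdj m c (i , j) = (c ≡ i) ⊎ (c ≡ csuc i)

Subgraph : ℕ → ℕ → Set
Subgraph m n = Fin m → Fin n → Bool

-- H is isomorphic to the double cycle over C_m with one white vertex removed,
-- with black vertices ↦ the m-class and white vertices ↦ the n-class.
-- σ identifies the black vertices; τ identifies the white vertices of the
-- double cycle with Fin n ⊎ ⊤, where the white vertex sent to the extra
-- point (inj₂ tt) is the removed one.
IsDoubleCycleMinusWhite : (m n : ℕ) → Subgraph m n → Set
IsDoubleCycleMinusWhite m n H =
  Σ[ σ ∈ (Fin m ↔ Fin m) ] Σ[ τ ∈ ((Fin m × Fin 2) ↔ (Fin n ⊎ ⊤)) ]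
    (∀ (b : Fin m) (w : Fin n) →
       (H b w ≡ true) ⇔ DCAdj m (Inverse.from σ b) (Inverse.from τ (inj₁ w)))

Covers : {m n k : ℕ} → (Fin k → Subgraph m n) → Set
Covers {m} {n} {k} H = ∀ (b : Fin m) (w : Fin n) → Σ[ t ∈ Fin k ] (H t b w ≡ true)

Distinct : {m n k : ℕ} → (Fin k → Subgraph m n) → Set
Distinct {m} {n} {k} H = ∀ (s t : Fin k) → ¬ (s ≡ t) →
  ¬ (∀ (b : Fin m) (w : Fin n) → H s b w ≡ H t b w)

-- Since 2m + n − 1 = 2n, the number of copies is k = ⌈m/2⌉.  Fix one identification of
-- the n = 2m − 1 white vertices of K_{m,n} with the white vertices of the double cycle
-- minus one, so each white vertex w sits on some cycle edge e_i; in copy t < k rotate the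
-- cycle by 2t, so that w is joined to the black vertices i + 2t and i + 2t + 1.  Every
-- black vertex is i + d with d < m ≤ 2k, so its edge to w lies in copy ⌊d/2⌋.  The
-- shifts 2t are distinct residues mod m, and two copies force m ≥ 3, so the copies differ.
module Submission where

open import Defs
open import Data.Bool using (true)
open import Data.Empty using (⊥-elim)
open import Data.Fin using (Fin; toℕ; fromℕ<; _≟_) renaming (zero to 0F)
open import Data.Fin.Properties using (toℕ-injective; toℕ<n; toℕ-fromℕ<; *↔×; +↔⊎; 1↔⊤)
open import Data.Nat using (ℕ; pred; zero; suc; _+_; _*_; _∸_; _≤_; _<_; s≤s; z<s; _%_; _/_)
open import Data.Nat.DivMod using (m≡m%n+[m/n]*n; m%n<n; m/n*n≤m; [m+n]%n≡m%n; m<n⇒m%n≡m; %-distribˡ-+; m%n%n≡m%n; m<n*o⇒m/o<n)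
open import Data.Nat.Properties hiding (_≟_)
open import Data.Nat.Tactic.RingSolver using (solve)
open import Data.List.Base using ([]; _∷_)
open import Data.Product using (_×_; _,_; Σ-syntax; proj₁; proj₂)
open import Data.Product.Function.NonDependent.Propositional using (_×-↔_)
open import Data.Sum using (_⊎_; inj₁; inj₂; [_,_])
open import Data.Sum.Function.Propositional using (_⊎-↔_)
open import Data.Unit using (⊤)
open import Function.Bundles using (_↔_; _⇔_; mk⇔; mk↔ₛ′; module Inverse; module Equivalence)
open import Function.Base using (_∘_)
open import Function.Properties.Inverse using (↔-refl; ↔-sym; ↔-trans)
open import Relation.Binary.PropositionalEquality using (_≡_; _≢_; refl; sym; trans; cong; subst; module ≡-Reasoning)
open import Relation.Binary.Definitions using (tri<; tri≈; tri>)
open import Relation.Nullary using (Dec; yes; no)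
open import Relation.Nullary.Decidable using (isYes; _⊎-dec_)

ceilDiv-lower : ∀ a b → a ≤ ceilDiv a (suc b) * suc b
ceilDiv-lower a b = +-cancelʳ-≤ b a (q * suc b) (begin
    a + b                       ≡⟨ m≡m%n+[m/n]*n (a + b) (suc b) ⟩
    (a + b) % suc b + q * suc b ≤⟨ +-monoˡ-≤ (q * suc b) (≤-pred (m%n<n (a + b) (suc b))) ⟩
    b + q * suc b               ≡⟨ +-comm b (q * suc b) ⟩
    q * suc b + b               ∎)
  where
  open ≤-Reasoning
  q = ceilDiv a (suc b)

ceilDiv-upper : ∀ a b → ceilDiv a (suc b) * suc b ≤ a + b
ceilDiv-upper a b = m/n*n≤m (a + b) (suc b)

ceilDiv-half-bounds : ∀ m N′ → let k = ceilDiv (m * suc N′) (2 * suc N′) in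
                      m ≤ k * 2 × k * 2 ≤ suc m
ceilDiv-half-bounds m N′ = *-cancelʳ-≤ m (k * 2) N lower , ≤-pred (*-cancelʳ-< N (k * 2) (2 + m) upper)
  where
  N = suc N′
  b = pred (2 * N)
  k = ceilDiv (m * N) (2 * N)
  regroup : k * (2 * N) ≡ k * 2 * N
  regroup = sym (*-assoc k 2 N)
  lower : m * N ≤ k * 2 * N
  lower = ≤-trans (ceilDiv-lower (m * N) b) (≤-reflexive regroup)
  upper : k * 2 * N < (2 + m) * N
  upper = begin-strict
    k * 2 * N     ≡⟨ sym regroup ⟩
    k * (2 * N)   ≤⟨ ceilDiv-upper (m * N) b ⟩
    m * N + b     <⟨ +-monoʳ-< (m * N) (n<1+n b) ⟩
    m * N + 2 * N ≡⟨ +-comm (m * N) (2 * N) ⟩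
    2 * N + m * N ≡⟨ *-distribʳ-+ N 2 m ⟨
    (2 + m) * N   ∎
    where open ≤-Reasoning

module _ {M : ℕ} where

  private
    m : ℕ
    m = suc M

  rotate : ℕ → Fin m → Fin m
  rotate zero    i = i
  rotate (suc d) i = csuc (rotate d i)

  rotate-+ : ∀ d e i → rotate (d + e) i ≡ rotate d (rotate e i)
  rotate-+ zero    e i = refl
  rotate-+ (suc d) e i = cong csuc (rotate-+ d e i)

  rotate-comm : ∀ d e i → rotate d (rotate e i) ≡ rotate e (rotate d i)
  rotate-comm d e i = begin
    rotate d (rotate e i) ≡⟨ rotate-+ d e i ⟨
    rotate (d + e) i      ≡⟨ cong (λ r → rotate r i) (+-comm d e) ⟩
    rotate (e + d) i      ≡⟨ rotate-+ e d i ⟩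
    rotate e (rotate d i) ∎
    where open ≡-Reasoning

  toℕ-rotate : ∀ d i → toℕ (rotate d i) ≡ (toℕ i + d) % m
  toℕ-rotate zero    i = sym (trans (cong (_% m) (+-identityʳ (toℕ i))) (m<n⇒m%n≡m (toℕ<n i)))
  toℕ-rotate (suc d) i = begin
    toℕ (csuc (rotate d i))    ≡⟨ toℕ-fromℕ< _ ⟩
    suc (toℕ (rotate d i)) % m ≡⟨ cong (λ x → suc x % m) (toℕ-rotate d i) ⟩
    (1 + x % m) % m            ≡⟨ %-distribˡ-+ 1 (x % m) m ⟩
    (1 % m + x % m % m) % m    ≡⟨ cong (λ y → (1 % m + y) % m) (m%n%n≡m%n x m) ⟩
    (1 % m + x % m) % m        ≡⟨ %-distribˡ-+ 1 x m ⟨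
    suc x % m                  ≡⟨ cong (_% m) (+-suc (toℕ i) d) ⟨
    (toℕ i + suc d) % m        ∎
    where
    open ≡-Reasoning
    x = toℕ i + d

  rotate-m : ∀ i → rotate m i ≡ i
  rotate-m i = toℕ-injective (begin
    toℕ (rotate m i) ≡⟨ toℕ-rotate m i ⟩
    (toℕ i + m) % m  ≡⟨ [m+n]%n≡m%n (toℕ i) m ⟩
    toℕ i % m        ≡⟨ m<n⇒m%n≡m (toℕ<n i) ⟩
    toℕ i            ∎)
    where open ≡-Reasoning

  rotate-*m : ∀ d i → rotate (d * m) i ≡ i
  rotate-*m zero    i = refl
  rotate-*m (suc d) i = trans (rotate-+ m (d * m) i) (trans (rotate-m _) (rotate-*m d i))

  rotate-inverseˡ : ∀ d i → rotate d (rotate (d * M) i) ≡ i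
  rotate-inverseˡ d i = begin
    rotate d (rotate (d * M) i) ≡⟨ rotate-+ d (d * M) i ⟨
    rotate (d + d * M) i        ≡⟨ cong (λ r → rotate r i) (*-suc d M) ⟨
    rotate (d * m) i            ≡⟨ rotate-*m d i ⟩
    i                           ∎
    where open ≡-Reasoning

  rotate-inverseʳ : ∀ d i → rotate (d * M) (rotate d i) ≡ i
  rotate-inverseʳ d i = trans (rotate-comm (d * M) d i) (rotate-inverseˡ d i)

  rotate-↔ : ℕ → Fin m ↔ Fin m
  rotate-↔ d = mk↔ₛ′ (rotate (d * M)) (rotate d) (rotate-inverseʳ d) (rotate-inverseˡ d)

  rotate-injectiveʳ : ∀ d {i j} → rotate d i ≡ rotate d j → i ≡ j
  rotate-injectiveʳ d {i} {j} eq =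
    trans (sym (rotate-inverseʳ d i)) (trans (cong (rotate (d * M)) eq) (rotate-inverseʳ d j))

  csuc-injective : ∀ {i j : Fin m} → csuc i ≡ csuc j → i ≡ j
  csuc-injective = rotate-injectiveʳ 1

  rotate-toℕ : ∀ i → rotate (toℕ i) 0F ≡ i
  rotate-toℕ i = toℕ-injective (trans (toℕ-rotate (toℕ i) 0F) (m<n⇒m%n≡m (toℕ<n i)))

  rotate-surjective : ∀ i j → Σ[ c ∈ Fin m ] rotate (toℕ c) i ≡ j
  rotate-surjective i j = c , (begin
    rotate (toℕ c) i                      ≡⟨ cong (rotate (toℕ c)) (rotate-toℕ i) ⟨
    rotate (toℕ c) (rotate (toℕ i) 0F)    ≡⟨ rotate-comm (toℕ c) (toℕ i) 0F ⟩
    rotate (toℕ i) (rotate (toℕ c) 0F)    ≡⟨ cong (rotate (toℕ i)) (rotate-toℕ c) ⟩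
    rotate (toℕ i) c                      ≡⟨ rotate-inverseˡ (toℕ i) j ⟩
    j                                     ∎)
    where
    open ≡-Reasoning
    c = rotate (toℕ i * M) j

  rotate-fixed : ∀ {e} i → 0 < e → rotate e i ≡ i → m ≤ e
  rotate-fixed {e} i 0<e fixed = positive-multiple q (+-cancelˡ-≡ (toℕ i) e (q * m) (begin
    toℕ i + e                 ≡⟨ m≡m%n+[m/n]*n (toℕ i + e) m ⟩
    (toℕ i + e) % m + q * m   ≡⟨ cong (_+ q * m) (trans (sym (toℕ-rotate e i)) (cong toℕ fixed)) ⟩
    toℕ i + q * m             ∎))
    where
    open ≡-Reasoning
    q = (toℕ i + e) / m
    positive-multiple : ∀ q → e ≡ q * m → m ≤ e
    positive-multiple zero    e≡0 = ⊥-elim (<⇒≢ 0<e (sym e≡0))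
    positive-multiple (suc q) refl = m≤m+n m (q * m)

  rotate-injective-< : ∀ {d e} i → d < e → e < m → rotate d i ≢ rotate e i
  rotate-injective-< {d} {e} i d<e e<m eq =
    <⇒≱ e<m (≤-trans (rotate-fixed (rotate d i) (m<n⇒0<n∸m d<e) loop) (m∸n≤m e d))
    where
    loop : rotate (e ∸ d) (rotate d i) ≡ rotate d i
    loop = begin
      rotate (e ∸ d) (rotate d i) ≡⟨ rotate-+ (e ∸ d) d i ⟨
      rotate (e ∸ d + d) i        ≡⟨ cong (λ r → rotate r i) (m∸n+n≡m (<⇒≤ d<e)) ⟩
      rotate e i                  ≡⟨ eq ⟨
      rotate d i                  ∎
      where open ≡-Reasoning

  rotate-injectiveˡ : ∀ {d e} i → d < m → e < m → rotate d i ≡ rotate e i → d ≡ e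
  rotate-injectiveˡ {d} {e} i d<m e<m eq with <-cmp d e
  ... | tri< d<e _ _ = ⊥-elim (rotate-injective-< i d<e e<m eq)
  ... | tri≈ _ d≡e _ = d≡e
  ... | tri> _ _ e<d = ⊥-elim (rotate-injective-< i e<d d<m (sym eq))

  DCAdj-rotate-<2 : ∀ {r} x j → r < 2 → DCAdj m (rotate r x) (x , j)
  DCAdj-rotate-<2 {zero}        x j _ = inj₁ refl
  DCAdj-rotate-<2 {suc zero}    x j _ = inj₂ refl
  DCAdj-rotate-<2 {suc (suc r)} x j (s≤s (s≤s ()))

  DCAdj-rotate-/2 : ∀ d i j → DCAdj m (rotate d i) (rotate (d / 2 * 2) i , j)
  DCAdj-rotate-/2 d i j = subst (λ b → DCAdj m b (rotate (d / 2 * 2) i , j)) (sym split)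
                                (DCAdj-rotate-<2 (rotate (d / 2 * 2) i) j (m%n<n d 2))
    where
    split : rotate d i ≡ rotate (d % 2) (rotate (d / 2 * 2) i)
    split = trans (cong (λ r → rotate r i) (m≡m%n+[m/n]*n d 2)) (rotate-+ (d % 2) (d / 2 * 2) i)

  adjacent-unique : ∀ {A B : Fin m} → 2 < m →
                    (∀ b → b ≡ A ⊎ b ≡ csuc A → b ≡ B ⊎ b ≡ csuc B) → A ≡ B
  adjacent-unique {A} {B} 2<m incl with incl A (inj₁ refl) | incl (csuc A) (inj₂ refl)
  ... | inj₁ A≡B  | _          = A≡B
  ... | inj₂ _    | inj₂ sA≡sB = csuc-injective sA≡sB
  ... | inj₂ A≡sB | inj₁ sA≡B  = ⊥-elim (<⇒≱ 2<m (rotate-fixed B z<s (trans (cong csuc (sym A≡sB)) sA≡B)))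

DCAdj? : ∀ {m} (c : Fin m) x → Dec (DCAdj m c x)
DCAdj? c (i , j) = (c ≟ i) ⊎-dec (c ≟ csuc i)

isYes≡true⇔ : ∀ {P : Set} (p? : Dec P) → (isYes p? ≡ true) ⇔ P
isYes≡true⇔ (yes p) = mk⇔ (λ _ → p) (λ _ → refl)
isYes≡true⇔ (no ¬p) = mk⇔ (λ ()) (λ p → ⊥-elim (¬p p))

doubleCycleSubgraph : ∀ {m n} → (Fin m × Fin 2) ↔ (Fin n ⊎ ⊤) → Subgraph m n
doubleCycleSubgraph τ b w = isYes (DCAdj? b (Inverse.from τ (inj₁ w)))

doubleCycleSubgraph-edge : ∀ {m n} (τ : (Fin m × Fin 2) ↔ (Fin n ⊎ ⊤)) b w →
                           (doubleCycleSubgraph τ b w ≡ true) ⇔ DCAdj m b (Inverse.from τ (inj₁ w))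
doubleCycleSubgraph-edge τ b w = isYes≡true⇔ (DCAdj? b (Inverse.from τ (inj₁ w)))

doubleCycleSubgraph-isDoubleCycleMinusWhite : ∀ {m n} (τ : (Fin m × Fin 2) ↔ (Fin n ⊎ ⊤)) →
                                              IsDoubleCycleMinusWhite m n (doubleCycleSubgraph τ)
doubleCycleSubgraph-isDoubleCycleMinusWhite τ = ↔-refl , τ , doubleCycleSubgraph-edge τ

module RotatedCopies {M n k : ℕ} (τ₀ : (Fin (suc M) × Fin 2) ↔ (Fin n ⊎ ⊤))
                     (m≤k*2 : suc M ≤ k * 2) (k*2≤1+m : k * 2 ≤ suc (suc M)) where

  private
    m : ℕ
    m = suc M

  position : Fin n → Fin m × Fin 2
  position w = Inverse.from τ₀ (inj₁ w)

  τ : Fin k → (Fin m × Fin 2) ↔ (Fin n ⊎ ⊤)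
  τ t = ↔-trans (rotate-↔ (toℕ t * 2) ×-↔ ↔-refl) τ₀

  H : Fin k → Subgraph m n
  H t = doubleCycleSubgraph (τ t)

  H-isDoubleCycleMinusWhite : ∀ t → IsDoubleCycleMinusWhite m n (H t)
  H-isDoubleCycleMinusWhite t = doubleCycleSubgraph-isDoubleCycleMinusWhite (τ t)

  H-edge : ∀ t b w →
           (H t b w ≡ true) ⇔ DCAdj m b (rotate (toℕ t * 2) (proj₁ (position w)) , proj₂ (position w))
  H-edge t = doubleCycleSubgraph-edge (τ t)

  shift<m : ∀ (t : Fin k) → toℕ t * 2 < m
  shift<m t = ≤-pred (≤-trans (*-monoˡ-≤ 2 (toℕ<n t)) k*2≤1+m)

  H-covers : Covers H
  H-covers b w with rotate-surjective (proj₁ (position w)) b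
  ... | c , reaches-b = fromℕ< half<k , Equivalence.from (H-edge (fromℕ< half<k) b w) adjacent
    where
    i = proj₁ (position w)
    j = proj₂ (position w)
    half<k : toℕ c / 2 < k
    half<k = m<n*o⇒m/o<n (<-≤-trans (toℕ<n c) m≤k*2)
    adjacent : DCAdj m b (rotate (toℕ (fromℕ< half<k) * 2) i , j)
    adjacent rewrite toℕ-fromℕ< half<k =
      subst (λ b′ → DCAdj m b′ (rotate (toℕ c / 2 * 2) i , j)) reaches-b (DCAdj-rotate-/2 (toℕ c) i j)

  H-distinct : Fin n → Distinct H
  H-distinct w s t s≢t same = s≢t (toℕ-injective (*-cancelʳ-≡ (toℕ s) (toℕ t) 2
      (rotate-injectiveˡ i (shift<m s) (shift<m t) (adjacent-unique 2<m incl))))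
    where
    i = proj₁ (position w)
    j = proj₂ (position w)
    incl : ∀ b → DCAdj m b (rotate (toℕ s * 2) i , j) → DCAdj m b (rotate (toℕ t * 2) i , j)
    incl b = Equivalence.to (H-edge t b w) ∘ subst (_≡ true) (same b w) ∘ Equivalence.from (H-edge s b w)
    2<m-from : ∀ u → 0 < toℕ u → 2 < m
    2<m-from u 0<u = ≤-<-trans (*-monoˡ-≤ 2 0<u) (shift<m u)
    nonzero : 0 < toℕ s ⊎ 0 < toℕ t
    nonzero with toℕ s in es | toℕ t in et
    ... | suc _ | _     = inj₁ z<s
    ... | zero  | suc _ = inj₂ z<s
    ... | zero  | zero  = ⊥-elim (s≢t (toℕ-injective (trans es (sym et))))
    2<m : 2 < m
    2<m = [ 2<m-from s , 2<m-from t ] nonzero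

whites↔ : ∀ {m n} → m * 2 ≡ n + 1 → (Fin m × Fin 2) ↔ (Fin n ⊎ ⊤)
whites↔ {n = n} eq = ↔-trans (↔-sym *↔×)
  (subst (λ x → Fin x ↔ (Fin n ⊎ ⊤)) (sym eq) (↔-trans +↔⊎ (↔-refl ⊎-↔ 1↔⊤)))

2*[1+M]∸1≡1+2*M : ∀ M → 2 * suc M ∸ 1 ≡ suc (2 * M)
2*[1+M]∸1≡1+2*M M = +-suc M (M + 0)

m*2≡n+1 : ∀ M → let n = 2 * suc M ∸ 1 in suc M * 2 ≡ n + 1
m*2≡n+1 M rewrite 2*[1+M]∸1≡1+2*M M = solve (M ∷ [])

2m+n∸1≡2n : ∀ M → let n = 2 * suc M ∸ 1 in 2 * suc M + n ∸ 1 ≡ 2 * n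
2m+n∸1≡2n M rewrite 2*[1+M]∸1≡1+2*M M = solve (M ∷ [])

lemma14 : (m : ℕ) → 2 ≤ m →
    let n = 2 * m ∸ 1 in
    Σ[ H ∈ (Fin (ceilDiv (m * n) (2 * m + n ∸ 1)) → Subgraph m n) ]
      ((∀ t → IsDoubleCycleMinusWhite m n (H t)) × Distinct H × Covers H)
lemma14 m@(suc M@(suc _)) (s≤s (s≤s _)) = H , H-isDoubleCycleMinusWhite , H-distinct 0F , H-covers
  where
  n = 2 * m ∸ 1
  k = ceilDiv (m * n) (2 * m + n ∸ 1)
  bounds : m ≤ k * 2 × k * 2 ≤ suc m
  bounds = subst (λ D → let k′ = ceilDiv (m * n) D in m ≤ k′ * 2 × k′ * 2 ≤ suc m)
                 (sym (2m+n∸1≡2n M)) (ceilDiv-half-bounds m (pred n))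
  open RotatedCopies {M} {n} {k} (whites↔ (m*2≡n+1 M)) (proj₁ bounds) (proj₂ bounds)
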